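{- Suppose that the following statement (A) holds: every $D(4)$-triple $\{a,b,c\}$ has a unique extension to a $D(4)$-quadruple $\{a,b,c,d\}$ by an element $d>\max\{a,b,c\}$. Then the following statement (B) holds: if $\{a_1,b,c,d\}$ is a $D(4)$-quadruple with $a_1<b<c<d$, then $\{a_2,b,c,d\}$ is not a $D(4)$-quadruple for any positive integer $a_2$ with $a_2\neq a_1$ and $a_2<b$.
   Context: A set of distinct positive integers is a $D(4)$-$m$-tuple ($D(4)$-triple for $m=3$, $D(4)$-quadruple for $m=4$) if the product of any two of its distinct elements increased by $4$ is a perfect square. -}

module Defs where

open import Data.Nat using (ℕ; _+_; _*_; _<_; _⊔_)
open import Data.Product using (Σ; ∃; _×_)
open import Relation.Binary.PropositionalEquality using (_≡_; _≢_)
open import Relation.Nullary using (¬_)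

IsSquare : ℕ → Set
IsSquare n = ∃ λ k → k * k ≡ n

D4 : ℕ → ℕ → Set
D4 x y = IsSquare (x * y + 4)

Positive : ℕ → Set
Positive x = 0 < x

D4Triple : ℕ → ℕ → ℕ → Set
D4Triple a b c =
  (Positive a × Positive b × Positive c) ×
  (a ≢ b × a ≢ c × b ≢ c) ×
  (D4 a b × D4 a c × D4 b c)

D4Quadruple : ℕ → ℕ → ℕ → ℕ → Set
D4Quadruple a b c d =
  (Positive a × Positive b × Positive c × Positive d) ×
  (a ≢ b × a ≢ c × a ≢ d × b ≢ c × b ≢ d × c ≢ d) ×
  (D4 a b × D4 a c × D4 a d × D4 b c × D4 b d × D4 c d)

StatementA : Set
StatementA = ∀ a b c → D4Triple a b c →
  (∃ λ d → (a ⊔ b ⊔ c) < d × D4Quadruple a b c d) ×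
  (∀ d d' → (a ⊔ b ⊔ c) < d → D4Quadruple a b c d →
            (a ⊔ b ⊔ c) < d' → D4Quadruple a b c d' → d ≡ d')

StatementB : Set
StatementB = ∀ a₁ b c d → D4Quadruple a₁ b c d → a₁ < b → b < c → c < d →
  ∀ a₂ → 0 < a₂ → a₂ ≢ a₁ → a₂ < b → ¬ D4Quadruple a₂ b c d

-- For a D(4)-triple {a,b,c} with ab+4 = r², ac+4 = s², bc+4 = t², the number
-- d₊ = a + b + c + (abc + rst)/2 always extends it to a D(4)-quadruple, since
-- 4(ad₊ + 4) = (at + rs)² and similarly for b and c; parity shows the halvings
-- are exact. So (A) forces d = d₊(a₁,b,c) = d₊(a₂,b,c). But d₊ is strictly
-- increasing in a (with b and c fixed, r and s grow with a), so a₁ = a₂.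
module Submission where

open import Defs
open import Data.Nat.Base using (ℕ; zero; suc; _+_; _*_; _<_; _≤_; _⊔_; ⌊_/2⌋; parity)
open import Data.Nat.Properties
open import Data.Nat.Tactic.RingSolver using (solve-∀)
open import Data.Parity.Base as ℙ using (0ℙ; 1ℙ)
import Data.Parity.Properties as ℙ
open import Data.Product using (_×_; _,_; proj₁; proj₂)
open import Relation.Binary.Definitions using (tri<; tri≈; tri>)
open import Relation.Binary.PropositionalEquality
open import Relation.Nullary using (yes; no; contradiction)

open ≡-Reasoning

parity-root : ∀ r x y → r * r ≡ x * y + 4 → parity r ≡ parity x ℙ.* parity y
parity-root r x y r² = begin
  parity r               ≡⟨ sym (ℙ.*-idem (parity r)) ⟩
  parity r ℙ.* parity r  ≡⟨ sym (ℙ.*-homo-* r r) ⟩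
  parity (r * r)         ≡⟨ cong parity r² ⟩
  parity (x * y + 4)     ≡⟨ ℙ.+-homo-+ (x * y) 4 ⟩
  parity (x * y) ℙ.+ 0ℙ  ≡⟨ ℙ.+-identityʳ _ ⟩
  parity (x * y)         ≡⟨ ℙ.*-homo-* x y ⟩
  parity x ℙ.* parity y  ∎

x*yz+xy*xz≡0ℙ : ∀ x y z → (x ℙ.* (y ℙ.* z)) ℙ.+ ((x ℙ.* y) ℙ.* (x ℙ.* z)) ≡ 0ℙ
x*yz+xy*xz≡0ℙ 0ℙ y z = refl
x*yz+xy*xz≡0ℙ 1ℙ y z = ℙ.p+p≡0ℙ (y ℙ.* z)

xyz+xy*xz*yz≡0ℙ : ∀ x y z →
  (x ℙ.* y ℙ.* z) ℙ.+ ((x ℙ.* y) ℙ.* (x ℙ.* z) ℙ.* (y ℙ.* z)) ≡ 0ℙ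
xyz+xy*xz*yz≡0ℙ 0ℙ y z = refl
xyz+xy*xz*yz≡0ℙ 1ℙ y z =
  trans (cong ((y ℙ.* z) ℙ.+_) (ℙ.*-idem (y ℙ.* z))) (ℙ.p+p≡0ℙ (y ℙ.* z))

xp+qw-even : ∀ x y z p q w →
  p * p ≡ y * z + 4 → q * q ≡ x * y + 4 → w * w ≡ x * z + 4 →
  parity (x * p + q * w) ≡ 0ℙ
xp+qw-even x y z p q w p² q² w² = begin
  parity (x * p + q * w)                   ≡⟨ ℙ.+-homo-+ (x * p) (q * w) ⟩
  parity (x * p) ℙ.+ parity (q * w)
    ≡⟨ cong₂ ℙ._+_ (trans (ℙ.*-homo-* x p) (cong (parity x ℙ.*_) (parity-root p y z p²)))
                    (trans (ℙ.*-homo-* q w)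
                           (cong₂ ℙ._*_ (parity-root q x y q²) (parity-root w x z w²))) ⟩
  (parity x ℙ.* (parity y ℙ.* parity z)) ℙ.+
    ((parity x ℙ.* parity y) ℙ.* (parity x ℙ.* parity z))
    ≡⟨ x*yz+xy*xz≡0ℙ (parity x) (parity y) (parity z) ⟩
  0ℙ                                       ∎

abc+rst-even : ∀ a b c r s t →
  r * r ≡ a * b + 4 → s * s ≡ a * c + 4 → t * t ≡ b * c + 4 →
  parity (a * b * c + r * s * t) ≡ 0ℙ
abc+rst-even a b c r s t r² s² t² = begin
  parity (a * b * c + r * s * t)  ≡⟨ ℙ.+-homo-+ (a * b * c) (r * s * t) ⟩
  parity (a * b * c) ℙ.+ parity (r * s * t)
    ≡⟨ cong₂ ℙ._+_ (parity₃ a b c)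
         (trans (parity₃ r s t) (cong₂ ℙ._*_
           (cong₂ ℙ._*_ (parity-root r a b r²) (parity-root s a c s²)) (parity-root t b c t²))) ⟩
  (parity a ℙ.* parity b ℙ.* parity c) ℙ.+
    ((parity a ℙ.* parity b) ℙ.* (parity a ℙ.* parity c) ℙ.* (parity b ℙ.* parity c))
    ≡⟨ xyz+xy*xz*yz≡0ℙ (parity a) (parity b) (parity c) ⟩
  0ℙ                              ∎
  where
  parity₃ : ∀ x y z → parity (x * y * z) ≡ parity x ℙ.* parity y ℙ.* parity z
  parity₃ x y z = trans (ℙ.*-homo-* (x * y) z) (cong (ℙ._* parity z) (ℙ.*-homo-* x y))

⌊n/2⌋+⌊n/2⌋≡n : ∀ n → parity n ≡ 0ℙ → ⌊ n /2⌋ + ⌊ n /2⌋ ≡ n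
⌊n/2⌋+⌊n/2⌋≡n zero          _    = refl
⌊n/2⌋+⌊n/2⌋≡n (suc (suc n)) even =
  cong suc (trans (+-suc ⌊ n /2⌋ ⌊ n /2⌋) (cong suc (⌊n/2⌋+⌊n/2⌋≡n n even)))

m*m≤n*n⇒m≤n : ∀ {m n} → m * m ≤ n * n → m ≤ n
m*m≤n*n⇒m≤n {m} {n} m²≤n² with m ≤? n
... | yes m≤n = m≤n
... | no  m≰n = contradiction m²≤n² (<⇒≱ (*-mono-< (≰⇒> m≰n) (≰⇒> m≰n)))

⊔-lub₃-< : ∀ {a b c d} → a < d → b < d → c < d → a ⊔ b ⊔ c < d
⊔-lub₃-< a<d b<d c<d = ⊔-lub (⊔-lub a<d b<d) c<d

square-root-mono : ∀ {r r' m n} → r * r ≡ m → r' * r' ≡ n → m ≤ n → r ≤ r'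
square-root-mono r² r'² m≤n = m*m≤n*n⇒m≤n (subst₂ _≤_ (sym r²) (sym r'²) m≤n)

4*[xe+4]≡[xp+qw]² : ∀ x y z p q w e →
  p * p ≡ y * z + 4 → q * q ≡ x * y + 4 → w * w ≡ x * z + 4 →
  e + e ≡ 2 * (x + y + z) + (x * y * z + p * q * w) →
  4 * (x * e + 4) ≡ (x * p + q * w) * (x * p + q * w)
4*[xe+4]≡[xp+qw]² x y z p q w e p² q² w² 2e = begin
  4 * (x * e + 4)                                          ≡⟨ double-e x e ⟩
  2 * x * (e + e) + 16                                     ≡⟨ cong (λ v → 2 * x * v + 16) 2e ⟩
  2 * x * (2 * (x + y + z) + (x * y * z + p * q * w)) + 16 ≡⟨ factor x y z p q w ⟩
  x * x * (y * z + 4) + 2 * x * (p * q * w) + (x * y + 4) * (x * z + 4)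
    ≡⟨ cong₂ (λ i j → x * x * i + 2 * x * (p * q * w) + j)
             (sym p²) (cong₂ _*_ (sym q²) (sym w²)) ⟩
  x * x * (p * p) + 2 * x * (p * q * w) + (q * q) * (w * w) ≡⟨ complete-square x p q w ⟩
  (x * p + q * w) * (x * p + q * w)                        ∎
  where
  double-e : ∀ x e → 4 * (x * e + 4) ≡ 2 * x * (e + e) + 16
  double-e = solve-∀
  factor : ∀ x y z p q w →
    2 * x * (2 * (x + y + z) + (x * y * z + p * q * w)) + 16
      ≡ x * x * (y * z + 4) + 2 * x * (p * q * w) + (x * y + 4) * (x * z + 4)
  factor = solve-∀
  complete-square : ∀ x p q w →
    x * x * (p * p) + 2 * x * (p * q * w) + (q * q) * (w * w) ≡ (x * p + q * w) * (x * p + q * w)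
  complete-square = solve-∀

D4-regular : ∀ x y z p q w e →
  p * p ≡ y * z + 4 → q * q ≡ x * y + 4 → w * w ≡ x * z + 4 →
  e + e ≡ 2 * (x + y + z) + (x * y * z + p * q * w) →
  D4 x e
D4-regular x y z p q w e p² q² w² 2e = u , *-cancelˡ-≡ (u * u) (x * e + 4) 4 (begin
  4 * (u * u)        ≡⟨ four-squares u ⟩
  (u + u) * (u + u)  ≡⟨ cong (λ v → v * v) (⌊n/2⌋+⌊n/2⌋≡n n n-even) ⟩
  n * n              ≡⟨ sym (4*[xe+4]≡[xp+qw]² x y z p q w e p² q² w² 2e) ⟩
  4 * (x * e + 4)    ∎)
  where
  n u : ℕ
  n = x * p + q * w
  u = ⌊ n /2⌋
  four-squares : ∀ u → 4 * (u * u) ≡ (u + u) * (u + u)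
  four-squares = solve-∀
  n-even : parity n ≡ 0ℙ
  n-even = xp+qw-even x y z p q w p² q² w²

-- r, s, t are the square roots carried by the triple; the halving is exact by abc+rst-even.
d₊ : ∀ {a b c} → D4Triple a b c → ℕ
d₊ {a} {b} {c} (_ , _ , (r , _) , (s , _) , (t , _)) = a + b + c + ⌊ a * b * c + r * s * t /2⌋

d₊-extends : ∀ {a b c} (T : D4Triple a b c) → a ⊔ b ⊔ c < d₊ T × D4Quadruple a b c (d₊ T)
d₊-extends {a} {b} {c} T@((0<a , 0<b , 0<c) , (a≢b , a≢c , b≢c) , (r , r²) , (s , s²) , (t , t²)) =
  ⊔-lub₃-< a<e b<e c<e ,
  ((0<a , 0<b , 0<c , m<n⇒0<n a<e) ,
   (a≢b , a≢c , <⇒≢ a<e , b≢c , <⇒≢ b<e , <⇒≢ c<e) ,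
   ((r , r²) , (s , s²) ,
    D4-regular a b c t r s e t² r² s² (trans 2e (regroup-a a b c r s t)) ,
    (t , t²) ,
    D4-regular b a c s r t e s² (trans r² (cong (_+ 4) (*-comm a b))) t²
      (trans 2e (regroup-b a b c r s t)) ,
    D4-regular c a b r s t e r² (trans s² (cong (_+ 4) (*-comm a c)))
      (trans t² (cong (_+ 4) (*-comm b c)))
      (trans 2e (regroup-c a b c r s t))))
  where
  e X : ℕ
  e = d₊ T
  X = a * b * c + r * s * t
  2e : e + e ≡ 2 * (a + b + c) + X
  2e = begin
    e + e                                        ≡⟨ double-sum (a + b + c) ⌊ X /2⌋ ⟩
    2 * (a + b + c) + (⌊ X /2⌋ + ⌊ X /2⌋)
      ≡⟨ cong (2 * (a + b + c) +_) (⌊n/2⌋+⌊n/2⌋≡n X (abc+rst-even a b c r s t r² s² t²)) ⟩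
    2 * (a + b + c) + X                          ∎
    where
    double-sum : ∀ m h → (m + h) + (m + h) ≡ 2 * m + (h + h)
    double-sum = solve-∀
  -- d₊ is symmetric in a, b, c (permuting r, s, t along), so each can play x in D4-regular.
  regroup-a : ∀ a b c r s t →
    2 * (a + b + c) + (a * b * c + r * s * t) ≡ 2 * (a + b + c) + (a * b * c + t * r * s)
  regroup-a = solve-∀
  regroup-b : ∀ a b c r s t →
    2 * (a + b + c) + (a * b * c + r * s * t) ≡ 2 * (b + a + c) + (b * a * c + s * r * t)
  regroup-b = solve-∀
  regroup-c : ∀ a b c r s t →
    2 * (a + b + c) + (a * b * c + r * s * t) ≡ 2 * (c + a + b) + (c * a * b + r * s * t)
  regroup-c = solve-∀
  sum≤e : a + b + c ≤ e
  sum≤e = m≤m+n (a + b + c) ⌊ X /2⌋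
  a<e : a < e
  a<e = <-≤-trans (<-≤-trans (m<m+n a 0<b) (m≤m+n (a + b) c)) sum≤e
  b<e : b < e
  b<e = <-≤-trans (<-≤-trans (m<n+m b 0<a) (m≤m+n (a + b) c)) sum≤e
  c<e : c < e
  c<e = <-≤-trans (m<n+m c (<-≤-trans 0<a (m≤m+n a b))) sum≤e

d₊-monoˡ-< : ∀ {a a' b c} (T : D4Triple a b c) (T' : D4Triple a' b c) → a < a' → d₊ T < d₊ T'
d₊-monoˡ-< {a} {a'} {b} {c}
  (_ , _ , (r , r²) , (s , s²) , (t , t²)) (_ , _ , (r' , r'²) , (s' , s'²) , (t' , t'²)) a<a' =
  +-mono-<-≤ (+-monoˡ-< c (+-monoˡ-< b a<a'))
             (⌊n/2⌋-mono (+-mono-≤ (*-monoˡ-≤ c ab≤a'b)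
                                   (*-mono-≤ (*-mono-≤ r≤r' s≤s') t≤t')))
  where
  ab≤a'b : a * b ≤ a' * b
  ab≤a'b = *-monoˡ-≤ b (<⇒≤ a<a')
  r≤r' : r ≤ r'
  r≤r' = square-root-mono r² r'² (+-monoˡ-≤ 4 ab≤a'b)
  s≤s' : s ≤ s'
  s≤s' = square-root-mono s² s'² (+-monoˡ-≤ 4 (*-monoˡ-≤ c (<⇒≤ a<a')))
  t≤t' : t ≤ t'
  t≤t' = square-root-mono t² t'² ≤-refl

d₊-injectiveˡ : ∀ {a a' b c} (T : D4Triple a b c) (T' : D4Triple a' b c) →
  d₊ T ≡ d₊ T' → a ≡ a'
d₊-injectiveˡ {a} {a'} T T' eq with <-cmp a a'
... | tri< a<a' _ _ = contradiction eq (<⇒≢ (d₊-monoˡ-< T T' a<a'))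
... | tri≈ _ a≡a' _ = a≡a'
... | tri> _ _ a>a' = contradiction (sym eq) (<⇒≢ (d₊-monoˡ-< T' T a>a'))

D4Quadruple⇒D4Triple : ∀ {a b c d} → D4Quadruple a b c d → D4Triple a b c
D4Quadruple⇒D4Triple ((0<a , 0<b , 0<c , _) , (a≢b , a≢c , _ , b≢c , _) , (ab , ac , _ , bc , _)) =
  (0<a , 0<b , 0<c) , (a≢b , a≢c , b≢c) , (ab , ac , bc)

StatementA⇒≡d₊ : StatementA → ∀ {a b c d} (T : D4Triple a b c) →
  a ⊔ b ⊔ c < d → D4Quadruple a b c d → d ≡ d₊ T
StatementA⇒≡d₊ A {a} {b} {c} {d} T max<d Q =
  proj₂ (A a b c T) d (d₊ T) max<d Q (proj₁ (d₊-extends T)) (proj₂ (d₊-extends T))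

corollary1p7 : StatementA → StatementB
corollary1p7 A a₁ b c d Q₁ a₁<b b<c c<d a₂ _ a₂≢a₁ a₂<b Q₂ =
  a₂≢a₁ (d₊-injectiveˡ (D4Quadruple⇒D4Triple Q₂) (D4Quadruple⇒D4Triple Q₁)
                       (trans (sym (d≡d₊ a₂<b Q₂)) (d≡d₊ a₁<b Q₁)))
  where
  b<d : b < d
  b<d = <-trans b<c c<d
  d≡d₊ : ∀ {a} → a < b → (Q : D4Quadruple a b c d) → d ≡ d₊ (D4Quadruple⇒D4Triple Q)
  d≡d₊ a<b Q =
    StatementA⇒≡d₊ A (D4Quadruple⇒D4Triple Q) (⊔-lub₃-< (<-trans a<b b<d) b<d c<d) Q
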